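{- Let $G$ be a density-minimal graph, and let $\mathrm{ComponentFamily}(G)$ be the family of all simple graphs each of whose connected components is a minor of $G$. Then the limiting density of $\mathrm{ComponentFamily}(G)$ equals the density of $G$.
   Context: All graphs are finite simple graphs. A minor of $G$ is a simple graph (with at least one vertex) obtained from $G$ by a sequence of edge contractions (merging resulting parallel edges and deleting resulting loops), edge deletions and vertex deletions; a proper minor is one obtained by at least one operation. The density of a graph with $m$ edges and $n$ vertices is $m/n$; $G$ is density-minimal if no proper minor of $G$ has density greater than or equal to that of $G$. For a minor-closed family $\mathcal{F}$, with $\mathrm{ex}_{\mathcal{F}}(n)$ the maximum number of edges of an $n$-vertex graph in $\mathcal{F}$ ($0$ if none), the limiting density is $\limsup_{n\to\infty}\mathrm{ex}_{\mathcal{F}}(n)/n$. -}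

module Defs where

open import Data.Nat using (ℕ; zero; suc; _+_; _*_; _≤_; _<_; _<ᵇ_)
open import Data.Fin using (Fin; toℕ; punchIn; _≟_)
open import Data.Bool using (Bool; true; false; _∧_; _∨_; not; if_then_else_)
open import Data.List using (List; map; allFin)
open import Data.Nat.ListAction using (sum)
open import Data.Product using (Σ; ∃; _×_; _,_)
open import Relation.Nullary using (does)
open import Relation.Binary.PropositionalEquality using (_≡_)
open import Relation.Binary.Construct.Closure.ReflexiveTransitive using (Star)
open import Function.Bundles using (_↔_; Inverse)
open import Function.Definitions using (Injective)

-- A graph has vertex set Fin n and a raw Boolean relation `rel`.
-- Every finite simple graph is represented this way (take rel = adjacency).

record Graph : Set where
  constructor mkGraph
  field
    n   : ℕ
    rel : Fin n → Fin n → Bool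

open Graph public

Adj′ : ∀ {k} → (Fin k → Fin k → Bool) → Fin k → Fin k → Bool
Adj′ r i j = not (does (i ≟ j)) ∧ (r i j ∨ r j i)

Adj : (G : Graph) → Fin (n G) → Fin (n G) → Bool
Adj G = Adj′ (rel G)

∣V∣ : Graph → ℕ
∣V∣ = n

∣E∣ : Graph → ℕ
∣E∣ G = sum (map (λ i → sum (map (λ j →
          if (toℕ i <ᵇ toℕ j) ∧ Adj G i j then 1 else 0)
          (allFin (n G)))) (allFin (n G)))

_≅_ : Graph → Graph → Set
H ≅ H′ = Σ (Fin (n H) ↔ Fin (n H′)) λ f →
  ∀ i j → Adj H i j ≡ Adj H′ (Inverse.to f i) (Inverse.to f j)

-- Single minor operations (the result always has at least one vertex
-- provided the input does).

delVertex : ∀ {k} → (Fin (suc (suc k)) → Fin (suc (suc k)) → Bool) →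
            Fin (suc (suc k)) → Fin (suc k) → Fin (suc k) → Bool
delVertex r v i j = Adj′ r (punchIn v i) (punchIn v j)

delEdge : ∀ {k} → (Fin k → Fin k → Bool) → Fin k → Fin k → Fin k → Fin k → Bool
delEdge r u w i j = Adj′ r i j ∧ not (  (does (i ≟ u) ∧ does (j ≟ w))
                                      ∨ (does (i ≟ w) ∧ does (j ≟ u)))

-- contract the edge {punchIn w u′ , w}: vertex w is merged into u = punchIn w u′;
-- parallel edges are merged and loops deleted (by the simple adjacency Adj′).
contract : ∀ {k} → (Fin (suc (suc k)) → Fin (suc (suc k)) → Bool) →
           Fin (suc (suc k)) → Fin (suc k) → Fin (suc k) → Fin (suc k) → Bool
contract r w u′ i j =
     Adj′ r (punchIn w i) (punchIn w j)
  ∨ (does (i ≟ u′) ∧ Adj′ r w (punchIn w j))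
  ∨ (does (j ≟ u′) ∧ Adj′ r w (punchIn w i))

data Step : Graph → Graph → Set where
  vertexDeletion : ∀ {k} (r : Fin (suc (suc k)) → Fin (suc (suc k)) → Bool)
                   (v : Fin (suc (suc k))) →
                   Step (mkGraph (suc (suc k)) r) (mkGraph (suc k) (delVertex r v))
  edgeDeletion   : ∀ {k} (r : Fin k → Fin k → Bool) (u w : Fin k) →
                   Adj′ r u w ≡ true →
                   Step (mkGraph k r) (mkGraph k (delEdge r u w))
  edgeContraction : ∀ {k} (r : Fin (suc (suc k)) → Fin (suc (suc k)) → Bool)
                   (w : Fin (suc (suc k))) (u′ : Fin (suc k)) →
                   Adj′ r (punchIn w u′) w ≡ true →
                   Step (mkGraph (suc (suc k)) r) (mkGraph (suc k) (contract r w u′))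

Minor : Graph → Graph → Set
Minor H G = ∃ λ H′ → Star Step G H′ × H ≅ H′

ProperMinor : Graph → Graph → Set
ProperMinor H G = ∃ λ G₁ → ∃ λ H′ → Step G G₁ × Star Step G₁ H′ × H ≅ H′

-- Density comparison: density(H) < density(G), i.e.
-- |E(H)|/|V(H)| < |E(G)|/|V(G)|, cross-multiplied.

DensityMinimal : Graph → Set
DensityMinimal G = ∀ H → ProperMinor H G → ∣E∣ H * ∣V∣ G < ∣E∣ G * ∣V∣ H

data Reach (G : Graph) : Fin (n G) → Fin (n G) → Set where
  here : ∀ {i} → Reach G i i
  step : ∀ {i j k} → Adj G i j ≡ true → Reach G j k → Reach G i k

Connected : Graph → Set
Connected G = 1 ≤ n G × (∀ i j → Reach G i j)

-- C is (isomorphic to) a connected component of H: C is connected, embeds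
-- into H as an induced subgraph via f, and the image of f is closed under
-- adjacency in H (so it is a maximal connected subgraph).
IsComponent : Graph → Graph → Set
IsComponent C H = Connected C × Σ (Fin (n C) → Fin (n H)) λ f →
    Injective _≡_ _≡_ f
  × (∀ i j → Adj C i j ≡ Adj H (f i) (f j))
  × (∀ i v → Adj H (f i) v ≡ true → ∃ λ j → f j ≡ v)

ComponentFamily : Graph → Graph → Set
ComponentFamily G H = ∀ C → IsComponent C H → Minor C G

-- A minor of the density-minimal graph G is either isomorphic to G or a proper minor, so its density is
-- at most d(G) = |E(G)|/|V(G)|.  A graph of the family is the disjoint union of its components, and the
-- density of a disjoint union is a mediant of the densities of its parts; peeling off one component at
-- a time, every graph of the family has density at most d(G), which gives the upper bound with no
-- error term at all.  Conversely, k disjoint copies of G lie in the family and have density exactly d(G).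
-- Edges are counted through the degree sum 2|E|, which is invariant under isomorphism and additive
-- over disjoint unions.

module Submission where

open import Defs
import Algebra.Properties.CommutativeMonoid.Sum as Sum
open import Data.Bool using (Bool; true; false; _∧_; _∨_; not; if_then_else_)
open import Data.Bool.Properties using (∨-comm; ∨-idem; not-injective) renaming (_≟_ to _≟ᵇ_)
open import Data.Empty using (⊥-elim)
open import Data.Fin using (Fin; zero; suc; toℕ; fromℕ<; punchIn; punchOut; _≟_; _↑ˡ_; _↑ʳ_; splitAt; join)
open import Data.Fin.Properties using (toℕ-injective; toℕ<n; suc-injective; any?; punchOut-injective; punchIn-punchOut; splitAt-↑ˡ; splitAt-↑ʳ; splitAt⁻¹-↑ˡ; splitAt⁻¹-↑ʳ; splitAt-join; join-splitAt; ↑ˡ-injective; ↑ʳ-injective; cantor-schröder-bernstein)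
open import Data.List using (map; allFin; tabulate)
open import Data.List.Properties using (map-tabulate)
import Data.Nat.ListAction as List
open import Data.Nat using (ℕ; zero; suc; _+_; _*_; _≤_; _<_; _<ᵇ_; z≤n; s≤s)
open import Data.Nat.Properties hiding (_≟_; suc-injective)
open import Data.Product using (Σ; ∃; _×_; _,_; proj₁; proj₂)
open import Data.Sum using (_⊎_; inj₁; inj₂; [_,_]′)
open import Function using (_∘_; id)
open import Function.Bundles using (Inverse; Injection; mk↔ₛ′)
open import Function.Properties.Inverse using (↔-sym; Inverse⇒Injection)
open import Function.Definitions using (Injective)
open import Relation.Binary.PropositionalEquality
open import Relation.Binary.Construct.Closure.ReflexiveTransitive using (ε; _◅_)
open import Relation.Nullary using (does; yes; no; ¬?; _×-dec_; ofʸ; ofⁿ)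
open import Relation.Nullary.Decidable using (decidable-stable; dec-true)

open Sum +-0-commutativeMonoid using (sum-syntax; sum-cong-≗; ∑-distrib-+; ∑-comm; ∑-permute; sum-replicate-zero)

∑-splitAt : ∀ m {k} (f : Fin (m + k) → ℕ) →
  ∑[ x < m + k ] f x ≡ ∑[ i < m ] f (i ↑ˡ k) + ∑[ j < k ] f (m ↑ʳ j)
∑-splitAt zero    f = refl
∑-splitAt (suc m) f = trans (cong (f zero +_) (∑-splitAt m (f ∘ suc))) (sym (+-assoc (f zero) _ _))

∑-mono-≤ : ∀ {n} {f g : Fin n → ℕ} → (∀ i → f i ≤ g i) → ∑[ i < n ] f i ≤ ∑[ i < n ] g i
∑-mono-≤ {zero}  f≤g = z≤n
∑-mono-≤ {suc n} f≤g = +-mono-≤ (f≤g zero) (∑-mono-≤ (f≤g ∘ suc))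

∑-mono-< : ∀ {n} {f g : Fin n → ℕ} → (∀ i → f i ≤ g i) → ∀ y → f y < g y →
  ∑[ i < n ] f i < ∑[ i < n ] g i
∑-mono-< f≤g zero    fy<gy = +-mono-<-≤ fy<gy (∑-mono-≤ (f≤g ∘ suc))
∑-mono-< f≤g (suc y) fy<gy = +-mono-≤-< (f≤g zero) (∑-mono-< (f≤g ∘ suc) y fy<gy)

sum-map-allFin : ∀ n (f : Fin n → ℕ) → List.sum (map f (allFin n)) ≡ ∑[ i < n ] f i
sum-map-allFin n f = trans (cong List.sum (map-tabulate id f)) (sum-tabulate n f)
  where
  sum-tabulate : ∀ n (f : Fin n → ℕ) → List.sum (tabulate f) ≡ ∑[ i < n ] f i
  sum-tabulate zero    f = refl
  sum-tabulate (suc n) f = cong (f zero +_) (sum-tabulate n (f ∘ suc))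

⟦_⟧ : Bool → ℕ
⟦ b ⟧ = if b then 1 else 0

Adj′-irrefl : ∀ {k} (r : Fin k → Fin k → Bool) i → Adj′ r i i ≡ false
Adj′-irrefl r i with i ≟ i
... | yes _   = refl
... | no i≢i = ⊥-elim (i≢i refl)

Adj′-sym : ∀ {k} (r : Fin k → Fin k → Bool) i j → Adj′ r i j ≡ Adj′ r j i
Adj′-sym r i j with i ≟ j | j ≟ i
... | yes _   | yes _   = refl
... | no _    | no _    = cong (true ∧_) (∨-comm (r i j) (r j i))
... | yes i≡j | no j≢i = ⊥-elim (j≢i (sym i≡j))
... | no i≢j  | yes j≡i = ⊥-elim (i≢j (sym j≡i))

Adj′-simple : ∀ {k} (r : Fin k → Fin k → Bool) → (∀ i → r i i ≡ false) →
  (∀ i j → r i j ≡ r j i) → ∀ i j → Adj′ r i j ≡ r i j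
Adj′-simple r irrefl sym-r i j with i ≟ j
... | yes refl = sym (irrefl i)
... | no _ rewrite sym-r j i = ∨-idem (r i j)

Adj-irrefl : ∀ H i → Adj H i i ≡ false
Adj-irrefl H = Adj′-irrefl (rel H)

Adj-sym : ∀ H i j → Adj H i j ≡ Adj H j i
Adj-sym H = Adj′-sym (rel H)

degreeSum : Graph → ℕ
degreeSum H = ∑[ i < n H ] ∑[ j < n H ] ⟦ Adj H i j ⟧

∣E∣-∑ : ∀ H → ∣E∣ H ≡ ∑[ i < n H ] ∑[ j < n H ] ⟦ (toℕ i <ᵇ toℕ j) ∧ Adj H i j ⟧
∣E∣-∑ H = trans (sum-map-allFin k (λ i → List.sum (map (row i) (allFin k))))
                (sum-cong-≗ λ i → sum-map-allFin k (row i))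
  where
  k = n H
  row : Fin k → Fin k → ℕ
  row i j = ⟦ (toℕ i <ᵇ toℕ j) ∧ Adj H i j ⟧

⟦⟧-split-<ᵇ : ∀ {k} (A : Fin k → Fin k → Bool) → (∀ i → A i i ≡ false) → ∀ i j →
  ⟦ A i j ⟧ ≡ ⟦ (toℕ i <ᵇ toℕ j) ∧ A i j ⟧ + ⟦ (toℕ j <ᵇ toℕ i) ∧ A i j ⟧
⟦⟧-split-<ᵇ A irrefl i j
  with toℕ i <ᵇ toℕ j | <ᵇ-reflects-< (toℕ i) (toℕ j)
     | toℕ j <ᵇ toℕ i | <ᵇ-reflects-< (toℕ j) (toℕ i)
... | true  | ofʸ i<j  | true  | ofʸ j<i = ⊥-elim (<-asym i<j j<i)
... | true  | _        | false | _       = sym (+-identityʳ _)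
... | false | _        | true  | _       = refl
... | false | ofⁿ i≮j  | false | ofⁿ j≮i
  rewrite toℕ-injective {i = i} {j} (≤-antisym (≮⇒≥ j≮i) (≮⇒≥ i≮j)) | irrefl j = refl

handshake : ∀ H → degreeSum H ≡ 2 * ∣E∣ H
handshake H = begin
  degreeSum H                                   ≡⟨ sum-cong-≗ (λ i → sum-cong-≗ (⟦⟧-split-<ᵇ (Adj H) (Adj-irrefl H) i)) ⟩
  ∑[ i < k ] ∑[ j < k ] (below i j + above i j) ≡⟨ sum-cong-≗ (λ i → ∑-distrib-+ (below i) (above i)) ⟩
  ∑[ i < k ] (∑[ j < k ] below i j + ∑[ j < k ] above i j)
                                                ≡⟨ ∑-distrib-+ (λ i → ∑[ j < k ] below i j) (λ i → ∑[ j < k ] above i j) ⟩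
  ∣E∣′ + ∑[ i < k ] ∑[ j < k ] above i j        ≡⟨ cong (∣E∣′ +_) (∑-comm above) ⟩
  ∣E∣′ + ∑[ j < k ] ∑[ i < k ] above i j        ≡⟨ cong (∣E∣′ +_) (sum-cong-≗ λ j → sum-cong-≗ λ i →
                                                     cong (λ b → ⟦ (toℕ j <ᵇ toℕ i) ∧ b ⟧) (Adj-sym H i j)) ⟩
  ∣E∣′ + ∣E∣′                                   ≡⟨ cong₂ _+_ (∣E∣-∑ H) (∣E∣-∑ H) ⟨
  ∣E∣ H + ∣E∣ H                                 ≡⟨ cong (∣E∣ H +_) (+-identityʳ _) ⟨
  2 * ∣E∣ H                                     ∎
  where
  open ≡-Reasoning
  k = n H
  below above : Fin k → Fin k → ℕ
  below i j = ⟦ (toℕ i <ᵇ toℕ j) ∧ Adj H i j ⟧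
  above i j = ⟦ (toℕ j <ᵇ toℕ i) ∧ Adj H i j ⟧
  ∣E∣′ = ∑[ i < k ] ∑[ j < k ] below i j

≅⇒∣V∣≡ : ∀ {H K} → H ≅ K → ∣V∣ H ≡ ∣V∣ K
≅⇒∣V∣≡ (σ , _) = cantor-schröder-bernstein (Injection.injective (Inverse⇒Injection σ))
                                           (Injection.injective (Inverse⇒Injection (↔-sym σ)))

≅⇒∣E∣≡ : ∀ {H K} → H ≅ K → ∣E∣ H ≡ ∣E∣ K
≅⇒∣E∣≡ {H} {K} (σ , adj) = *-cancelˡ-≡ _ _ 2 (begin
  2 * ∣E∣ H                                          ≡⟨ handshake H ⟨
  degreeSum H                                        ≡⟨ sum-cong-≗ (λ i → sum-cong-≗ λ j → cong ⟦_⟧ (adj i j)) ⟩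
  ∑[ i < n H ] ∑[ j < n H ] ⟦ Adj K (to i) (to j) ⟧  ≡⟨ sum-cong-≗ (λ i → ∑-permute (λ y → ⟦ Adj K (to i) y ⟧) σ) ⟨
  ∑[ i < n H ] ∑[ y < n K ] ⟦ Adj K (to i) y ⟧       ≡⟨ ∑-permute (λ x → ∑[ y < n K ] ⟦ Adj K x y ⟧) σ ⟨
  degreeSum K                                        ≡⟨ handshake K ⟩
  2 * ∣E∣ K                                          ∎)
  where
  open ≡-Reasoning
  open Inverse σ using (to)

-- IsComponent C H is, by definition, Connected C × ClosedEmbedding C H.
ClosedEmbedding : Graph → Graph → Set
ClosedEmbedding K H = Σ (Fin (n K) → Fin (n H)) λ f →
    Injective _≡_ _≡_ f
  × (∀ i j → Adj K i j ≡ Adj H (f i) (f j))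
  × (∀ i v → Adj H (f i) v ≡ true → ∃ λ j → f j ≡ v)

closedEmbedding-∘ : ∀ {C K H} → ClosedEmbedding K H → ClosedEmbedding C K → ClosedEmbedding C H
closedEmbedding-∘ {H = H} (e , e-inj , e-ind , e-closed) (f , f-inj , f-ind , f-closed) =
  e ∘ f , f-inj ∘ e-inj , (λ i j → trans (f-ind i j) (e-ind (f i) (f j))) , closed
  where
  closed : ∀ i v → Adj H (e (f i)) v ≡ true → ∃ λ j → e (f j) ≡ v
  closed i v adj with e-closed (f i) v adj
  ... | w , ew≡v with f-closed i w (trans (e-ind (f i) w) (trans (cong (Adj H (e (f i))) ew≡v) adj))
  ... | j , fj≡w = j , trans (cong e fj≡w) ew≡v

≅⇒closedEmbedding : ∀ {K H} → K ≅ H → ClosedEmbedding K H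
≅⇒closedEmbedding (σ , adj) =
  to , Injection.injective (Inverse⇒Injection σ) , adj , λ _ v _ → from v , strictlyInverseˡ v
  where open Inverse σ using (to; from; strictlyInverseˡ)

Reach-snoc : ∀ {H i j k} → Reach H i j → Adj H j k ≡ true → Reach H i k
Reach-snoc here       adj′ = step adj′ here
Reach-snoc (step adj r) adj′ = step adj (Reach-snoc r adj′)

Reach-trans : ∀ {H i j k} → Reach H i j → Reach H j k → Reach H i k
Reach-trans here         r′ = r′
Reach-trans (step adj r) r′ = step adj (Reach-trans r r′)

Reach-sym : ∀ {H i j} → Reach H i j → Reach H j i
Reach-sym         here                     = here
Reach-sym {H} {i} (step {j = j} adj r) = Reach-snoc (Reach-sym r) (trans (Adj-sym H j i) adj)

Reach-map : ∀ {K H} (f : Fin (n K) → Fin (n H)) → (∀ i j → Adj K i j ≡ Adj H (f i) (f j)) →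
  ∀ {i j} → Reach K i j → Reach H (f i) (f j)
Reach-map f ind here                   = here
Reach-map f ind (step {i} {j} adj r) = step (trans (sym (ind i j)) adj) (Reach-map f ind r)

Reach-lift : ∀ {K H} (emb : ClosedEmbedding K H) → let e = proj₁ emb in
  ∀ {x y} → Reach H x y → ∀ i → e i ≡ x → ∃ λ j → e j ≡ y × Reach K i j
Reach-lift emb here i ei≡x = i , ei≡x , here
Reach-lift {H = H} emb@(e , _ , e-ind , e-closed) (step {j = z} adj r) i refl
  with e-closed i z adj
... | k , ek≡z with Reach-lift emb r k ek≡z
... | j , ej≡y , rK = j , ej≡y , step (trans (e-ind i k) (trans (cong (Adj H (e i)) ek≡z) adj)) rK

Reach-reflect : ∀ {K H} (emb : ClosedEmbedding K H) → let e = proj₁ emb in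
  ∀ i j → Reach H (e i) (e j) → Reach K i j
Reach-reflect emb@(_ , e-inj , _) i j r with Reach-lift emb r i refl
... | j′ , ej′≡ej , rK with e-inj ej′≡ej
... | refl = rK

closedEmbedding-restrict : ∀ {C K H} (e : ClosedEmbedding K H) (f : ClosedEmbedding C H) →
  (∀ i j → Reach C i j) → ∀ c → (∃ λ k → proj₁ e k ≡ proj₁ f c) → ClosedEmbedding C K
closedEmbedding-restrict {C} {K} {H} e-emb@(e , e-inj , e-ind , e-closed) (f , f-inj , f-ind , f-closed)
  conn c (k , ek≡fc) = g , g-inj , g-ind , g-closed
  where
  lifted : ∀ i → ∃ λ j → e j ≡ f i × Reach K k j
  lifted i = Reach-lift e-emb (Reach-map {C} {H} f f-ind (conn c i)) k ek≡fc
  g : Fin (n C) → Fin (n K)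
  g i = proj₁ (lifted i)
  eg≡f : ∀ i → e (g i) ≡ f i
  eg≡f i = proj₁ (proj₂ (lifted i))
  g-inj : Injective _≡_ _≡_ g
  g-inj {i} {j} gi≡gj = f-inj (trans (sym (eg≡f i)) (trans (cong e gi≡gj) (eg≡f j)))
  g-ind : ∀ i j → Adj C i j ≡ Adj K (g i) (g j)
  g-ind i j = trans (f-ind i j) (trans (sym (cong₂ (Adj H) (eg≡f i) (eg≡f j))) (sym (e-ind (g i) (g j))))
  g-closed : ∀ i w → Adj K (g i) w ≡ true → ∃ λ j → g j ≡ w
  g-closed i w adj
    with f-closed i (e w) (trans (cong (λ x → Adj H x (e w)) (sym (eg≡f i))) (trans (sym (e-ind (g i) w)) adj))
  ... | j , fj≡ew = j , e-inj (trans (eg≡f j) fj≡ew)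

⊕-adj : (K₁ K₂ : Graph) → Fin (n K₁) ⊎ Fin (n K₂) → Fin (n K₁) ⊎ Fin (n K₂) → Bool
⊕-adj K₁ K₂ (inj₁ i) (inj₁ j) = Adj K₁ i j
⊕-adj K₁ K₂ (inj₂ i) (inj₂ j) = Adj K₂ i j
⊕-adj K₁ K₂ _        _        = false

infixr 30 _⊕_
_⊕_ : Graph → Graph → Graph
K₁ ⊕ K₂ = mkGraph (n K₁ + n K₂) λ x y → ⊕-adj K₁ K₂ (splitAt (n K₁) x) (splitAt (n K₁) y)

module _ (K₁ K₂ : Graph) where

  private
    a = n K₁
    b = n K₂

  ⊕-adj-irrefl : ∀ s → ⊕-adj K₁ K₂ s s ≡ false
  ⊕-adj-irrefl (inj₁ i) = Adj-irrefl K₁ i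
  ⊕-adj-irrefl (inj₂ i) = Adj-irrefl K₂ i

  ⊕-adj-sym : ∀ s t → ⊕-adj K₁ K₂ s t ≡ ⊕-adj K₁ K₂ t s
  ⊕-adj-sym (inj₁ i) (inj₁ j) = Adj-sym K₁ i j
  ⊕-adj-sym (inj₂ i) (inj₂ j) = Adj-sym K₂ i j
  ⊕-adj-sym (inj₁ i) (inj₂ j) = refl
  ⊕-adj-sym (inj₂ i) (inj₁ j) = refl

  Adj-⊕ : ∀ x y → Adj (K₁ ⊕ K₂) x y ≡ ⊕-adj K₁ K₂ (splitAt a x) (splitAt a y)
  Adj-⊕ = Adj′-simple _ (λ x → ⊕-adj-irrefl (splitAt a x)) (λ x y → ⊕-adj-sym (splitAt a x) (splitAt a y))

  Adj-⊕-join : ∀ s t → Adj (K₁ ⊕ K₂) (join a b s) (join a b t) ≡ ⊕-adj K₁ K₂ s t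
  Adj-⊕-join s t = trans (Adj-⊕ _ _) (cong₂ (⊕-adj K₁ K₂) (splitAt-join a b s) (splitAt-join a b t))

  degreeSum-⊕ : degreeSum (K₁ ⊕ K₂) ≡ degreeSum K₁ + degreeSum K₂
  degreeSum-⊕ = trans (∑-splitAt a _) (cong₂ _+_ (sum-cong-≗ row₁) (sum-cong-≗ row₂))
    where
    row : Fin a ⊎ Fin b → Fin (a + b) → ℕ
    row s y = ⟦ Adj (K₁ ⊕ K₂) (join a b s) y ⟧
    no-edges : ∀ s {m} (g : Fin m → Fin a ⊎ Fin b) → (∀ j → ⊕-adj K₁ K₂ s (g j) ≡ false) →
      ∑[ j < m ] row s (join a b (g j)) ≡ 0
    no-edges s {m} g none =
      trans (sum-cong-≗ λ j → cong ⟦_⟧ (trans (Adj-⊕-join s (g j)) (none j))) (sum-replicate-zero m)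
    row₁ : ∀ i → ∑[ y < a + b ] row (inj₁ i) y ≡ ∑[ j < a ] ⟦ Adj K₁ i j ⟧
    row₁ i = trans (∑-splitAt a _)
      (trans (cong₂ _+_ (sum-cong-≗ λ j → cong ⟦_⟧ (Adj-⊕-join (inj₁ i) (inj₁ j)))
                        (no-edges (inj₁ i) inj₂ λ _ → refl))
             (+-identityʳ _))
    row₂ : ∀ i → ∑[ y < a + b ] row (inj₂ i) y ≡ ∑[ j < b ] ⟦ Adj K₂ i j ⟧
    row₂ i = trans (∑-splitAt a _)
      (cong₂ _+_ (no-edges (inj₂ i) inj₁ λ _ → refl) (sum-cong-≗ λ j → cong ⟦_⟧ (Adj-⊕-join (inj₂ i) (inj₂ j))))

  ∣E∣-⊕ : ∣E∣ (K₁ ⊕ K₂) ≡ ∣E∣ K₁ + ∣E∣ K₂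
  ∣E∣-⊕ = *-cancelˡ-≡ _ _ 2 (begin
    2 * ∣E∣ (K₁ ⊕ K₂)            ≡⟨ handshake (K₁ ⊕ K₂) ⟨
    degreeSum (K₁ ⊕ K₂)          ≡⟨ degreeSum-⊕ ⟩
    degreeSum K₁ + degreeSum K₂  ≡⟨ cong₂ _+_ (handshake K₁) (handshake K₂) ⟩
    2 * ∣E∣ K₁ + 2 * ∣E∣ K₂      ≡⟨ *-distribˡ-+ 2 (∣E∣ K₁) (∣E∣ K₂) ⟨
    2 * (∣E∣ K₁ + ∣E∣ K₂)        ∎)
    where open ≡-Reasoning

  ⊕-closed : ∀ s v → Adj (K₁ ⊕ K₂) (join a b s) v ≡ true → ∃ λ t → join a b t ≡ v × ⊕-adj K₁ K₂ s t ≡ true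
  ⊕-closed s v adj =
    splitAt a v , join-splitAt a b v ,
    trans (sym (Adj-⊕-join s (splitAt a v))) (trans (cong (Adj (K₁ ⊕ K₂) (join a b s)) (join-splitAt a b v)) adj)

  ↑ˡ-closedEmbedding : ClosedEmbedding K₁ (K₁ ⊕ K₂)
  ↑ˡ-closedEmbedding = _↑ˡ b , ↑ˡ-injective b _ _ , (λ i j → sym (Adj-⊕-join (inj₁ i) (inj₁ j))) , closed
    where
    closed : ∀ i v → Adj (K₁ ⊕ K₂) (i ↑ˡ b) v ≡ true → ∃ λ j → j ↑ˡ b ≡ v
    closed i v adj with ⊕-closed (inj₁ i) v adj
    ... | inj₁ j , j↑ˡ≡v , _ = j , j↑ˡ≡v

  ↑ʳ-closedEmbedding : ClosedEmbedding K₂ (K₁ ⊕ K₂)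
  ↑ʳ-closedEmbedding = a ↑ʳ_ , ↑ʳ-injective a _ _ , (λ i j → sym (Adj-⊕-join (inj₂ i) (inj₂ j))) , closed
    where
    closed : ∀ i v → Adj (K₁ ⊕ K₂) (a ↑ʳ i) v ≡ true → ∃ λ j → a ↑ʳ j ≡ v
    closed i v adj with ⊕-closed (inj₂ i) v adj
    ... | inj₂ j , ↑ʳj≡v , _ = j , ↑ʳj≡v

  ⊕-component : ∀ {C} → IsComponent C (K₁ ⊕ K₂) → IsComponent C K₁ ⊎ IsComponent C K₂
  ⊕-component {C} ((nonempty , conn) , f) with splitAt a (proj₁ f c) in side
    where c = fromℕ< nonempty
  ... | inj₁ i = inj₁ ((nonempty , conn) ,
    closedEmbedding-restrict {C} {K₁} {K₁ ⊕ K₂} ↑ˡ-closedEmbedding f conn _ (i , splitAt⁻¹-↑ˡ side))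
  ... | inj₂ j = inj₂ ((nonempty , conn) ,
    closedEmbedding-restrict {C} {K₂} {K₁ ⊕ K₂} ↑ʳ-closedEmbedding f conn _ (j , splitAt⁻¹-↑ʳ side))

count : ∀ {n} → (Fin n → Bool) → ℕ
count {n} S = ∑[ x < n ] ⟦ S x ⟧

mutual
  enum : ∀ {n} (S : Fin n → Bool) → Fin (count S) → Fin n
  enum {suc n} S = enum-∷ (S zero) (S ∘ suc)

  enum-∷ : ∀ {n} b (S : Fin n → Bool) → Fin (⟦ b ⟧ + count S) → Fin (suc n)
  enum-∷ true  S zero    = zero
  enum-∷ true  S (suc k) = suc (enum S k)
  enum-∷ false S k       = suc (enum S k)

mutual
  enum-sound : ∀ {n} (S : Fin n → Bool) k → S (enum S k) ≡ true
  enum-sound {suc n} S = enum-∷-sound S refl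

  enum-∷-sound : ∀ {n} {b} (S : Fin (suc n) → Bool) → S zero ≡ b → ∀ k → S (enum-∷ b (S ∘ suc) k) ≡ true
  enum-∷-sound {b = true}  S S₀ zero    = S₀
  enum-∷-sound {b = true}  S S₀ (suc k) = enum-sound (S ∘ suc) k
  enum-∷-sound {b = false} S S₀ k       = enum-sound (S ∘ suc) k

mutual
  enum-injective : ∀ {n} (S : Fin n → Bool) → Injective _≡_ _≡_ (enum S)
  enum-injective {suc n} S = enum-∷-injective (S zero) (S ∘ suc)

  enum-∷-injective : ∀ {n} b (S : Fin n → Bool) → Injective _≡_ _≡_ (enum-∷ b S)
  enum-∷-injective true  S {zero}  {zero}  _  = refl
  enum-∷-injective true  S {suc k} {suc l} eq = cong suc (enum-injective S (suc-injective eq))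
  enum-∷-injective false S                 eq = enum-injective S (suc-injective eq)

mutual
  enum-complete : ∀ {n} (S : Fin n → Bool) x → S x ≡ true → ∃ λ k → enum S k ≡ x
  enum-complete {suc n} S = enum-∷-complete S refl

  enum-∷-complete : ∀ {n} {b} (S : Fin (suc n) → Bool) → S zero ≡ b →
    ∀ x → S x ≡ true → ∃ λ k → enum-∷ b (S ∘ suc) k ≡ x
  enum-∷-complete {b = true}  S S₀ zero    Sx = zero , refl
  enum-∷-complete {b = false} S S₀ zero    Sx with () ← trans (sym S₀) Sx
  enum-∷-complete {b = true}  S S₀ (suc x) Sx with k , eq ← enum-complete (S ∘ suc) x Sx = suc k , cong suc eq
  enum-∷-complete {b = false} S S₀ (suc x) Sx with k , eq ← enum-complete (S ∘ suc) x Sx = k , cong suc eq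

count-pos : ∀ {n} (S : Fin n → Bool) x → S x ≡ true → 1 ≤ count S
count-pos S x Sx = ≤-trans (s≤s z≤n) (toℕ<n (proj₁ (enum-complete S x Sx)))

Induced : (H : Graph) {m : ℕ} → (Fin m → Fin (n H)) → Graph
Induced H {m} f = mkGraph m λ i j → Adj H (f i) (f j)

Adj-Induced : ∀ H {m} (f : Fin m → Fin (n H)) i j → Adj (Induced H f) i j ≡ Adj H (f i) (f j)
Adj-Induced H f = Adj′-simple _ (λ i → Adj-irrefl H (f i)) (λ i j → Adj-sym H (f i) (f j))

Closed : (H : Graph) → (Fin (n H) → Bool) → Set
Closed H S = ∀ x y → S x ≡ true → Adj H x y ≡ true → S y ≡ true

module _ (H : Graph) {S : Fin (n H) → Bool} (closed : Closed H S) where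

  Closed⇒no-crossing : ∀ x y → S x ≡ true → S y ≡ false → Adj H x y ≡ false
  Closed⇒no-crossing x y Sx Sy with Adj H x y in adj
  ... | false = refl
  ... | true with () ← trans (sym Sy) (closed x y Sx adj)

  Closed-∁ : Closed H (not ∘ S)
  Closed-∁ x y S̄x adj with S y in Sy
  ... | false = refl
  ... | true with () ← trans (sym (Closed⇒no-crossing y x Sy (not-injective S̄x)))
                             (trans (Adj-sym H y x) adj)

  enum-closedEmbedding : ClosedEmbedding (Induced H (enum S)) H
  enum-closedEmbedding = enum S , enum-injective S , Adj-Induced H (enum S) ,
    λ k v adj → enum-complete S v (closed (enum S k) v (enum-sound S k) adj)

  split-≅ : Induced H (enum S) ⊕ Induced H (enum (not ∘ S)) ≅ H
  split-≅ = mk↔ₛ′ to from to-from (λ x → to-injective (to-from (to x))) , λ x y →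
    trans (Adj-⊕ (Induced H (enum S)) (Induced H (enum S̄)) x y) (adj (splitAt k x) (splitAt k y))
    where
    S̄ = not ∘ S
    k = count S
    l = count S̄
    to′ : Fin k ⊎ Fin l → Fin (n H)
    to′ = [ enum S , enum S̄ ]′
    to : Fin (k + l) → Fin (n H)
    to = to′ ∘ splitAt k
    from-side : ∀ x b → S x ≡ b → Fin (k + l)
    from-side x true  Sx = proj₁ (enum-complete S x Sx) ↑ˡ l
    from-side x false Sx = k ↑ʳ proj₁ (enum-complete S̄ x (cong not Sx))
    from : Fin (n H) → Fin (k + l)
    from x = from-side x (S x) refl
    to-from-side : ∀ x b (Sx : S x ≡ b) → to (from-side x b Sx) ≡ x
    to-from-side x true  Sx = trans (cong to′ (splitAt-↑ˡ k _ l)) (proj₂ (enum-complete S x Sx))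
    to-from-side x false Sx = trans (cong to′ (splitAt-↑ʳ k l _)) (proj₂ (enum-complete S̄ x (cong not Sx)))
    to-from : ∀ x → to (from x) ≡ x
    to-from x = to-from-side x (S x) refl
    disjoint : ∀ i j → enum S i ≢ enum S̄ j
    disjoint i j eq with () ← trans (sym (enum-sound S i)) (trans (cong S eq) (not-injective (enum-sound S̄ j)))
    to′-injective : Injective _≡_ _≡_ to′
    to′-injective {inj₁ i} {inj₁ j} eq = cong inj₁ (enum-injective S eq)
    to′-injective {inj₂ i} {inj₂ j} eq = cong inj₂ (enum-injective S̄ eq)
    to′-injective {inj₁ i} {inj₂ j} eq = ⊥-elim (disjoint i j eq)
    to′-injective {inj₂ i} {inj₁ j} eq = ⊥-elim (disjoint j i (sym eq))
    to-injective : Injective _≡_ _≡_ to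
    to-injective {x} {y} eq = begin
      x                       ≡⟨ join-splitAt k l x ⟨
      join k l (splitAt k x)  ≡⟨ cong (join k l) (to′-injective {splitAt k x} {splitAt k y} eq) ⟩
      join k l (splitAt k y)  ≡⟨ join-splitAt k l y ⟩
      y                       ∎
      where open ≡-Reasoning
    adj : ∀ s t → ⊕-adj (Induced H (enum S)) (Induced H (enum S̄)) s t ≡ Adj H (to′ s) (to′ t)
    adj (inj₁ i) (inj₁ j) = Adj-Induced H (enum S) i j
    adj (inj₂ i) (inj₂ j) = Adj-Induced H (enum S̄) i j
    adj (inj₁ i) (inj₂ j) = sym (Closed⇒no-crossing _ _ (enum-sound S i) (not-injective (enum-sound S̄ j)))
    adj (inj₂ i) (inj₁ j) = sym (trans (Adj-sym H _ _)
                                 (Closed⇒no-crossing _ _ (enum-sound S j) (not-injective (enum-sound S̄ i))))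

⟦not-∨⟧-≤ : ∀ a b → ⟦ not (a ∨ b) ⟧ ≤ ⟦ not a ⟧
⟦not-∨⟧-≤ true  _     = z≤n
⟦not-∨⟧-≤ false true  = z≤n
⟦not-∨⟧-≤ false false = s≤s z≤n

-- Grow S = {v} by one outgoing edge at a time; the number of vertices outside S bounds the number of rounds.
componentOf : ∀ H (v : Fin (n H)) → Σ (Fin (n H) → Bool) λ S →
  S v ≡ true × Closed H S × (∀ x → S x ≡ true → Reach H v x)
componentOf H v = grow _ (λ x → does (x ≟ v)) ≤-refl (dec-true (v ≟ v) refl) from-v
  where
  from-v : ∀ x → does (x ≟ v) ≡ true → Reach H v x
  from-v x x≡v with x ≟ v
  ... | yes refl = here
  grow : ∀ t S → count (not ∘ S) ≤ t → S v ≡ true → (∀ x → S x ≡ true → Reach H v x) →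
    Σ (Fin (n H) → Bool) λ S → S v ≡ true × Closed H S × (∀ x → S x ≡ true → Reach H v x)
  grow t S outside≤t Sv reach
    with any? (λ x → any? λ y → (S x ≟ᵇ true) ×-dec (Adj H x y ≟ᵇ true) ×-dec (S y ≟ᵇ false))
  ... | no no-exit = S , Sv , closed , reach
    where
    closed : Closed H S
    closed x y Sx adj with S y in Sy
    ... | true  = refl
    ... | false = ⊥-elim (no-exit (x , y , Sx , adj , Sy))
  ... | yes (x , y , Sx , adj , Sy) with t
  ...   | zero = ⊥-elim (<⇒≱ (count-pos (not ∘ S) y (cong not Sy)) outside≤t)
  ...   | suc t′ = grow t′ S′ (<⇒≤pred (<-≤-trans fewer-outside outside≤t)) (cong (_∨ _) Sv) reach′
    where
    S′ : Fin (n H) → Bool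
    S′ z = S z ∨ does (z ≟ y)
    fewer-outside : count (not ∘ S′) < count (not ∘ S)
    fewer-outside = ∑-mono-< (λ z → ⟦not-∨⟧-≤ (S z) _) y
      (subst₂ (λ a b → ⟦ not (a ∨ b) ⟧ < ⟦ not a ⟧) (sym Sy) (sym (dec-true (y ≟ y) refl)) (s≤s z≤n))
    reach′ : ∀ z → S′ z ≡ true → Reach H v z
    reach′ z S′z with S z in Sz | z ≟ y
    ... | true  | _        = reach z Sz
    ... | false | yes refl = Reach-snoc (reach x Sx) adj

peelComponent : ∀ H → Fin (n H) →
  Σ Graph λ C → Σ Graph λ H′ → IsComponent C H × ClosedEmbedding H′ H × C ⊕ H′ ≅ H
peelComponent H v with S , Sv , closed , reach ← componentOf H v =
  Induced H (enum S) , Induced H (enum (not ∘ S)) ,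
  ((count-pos S v Sv , connected) , enum-closedEmbedding H closed) ,
  enum-closedEmbedding H (Closed-∁ H closed) , split-≅ H closed
  where
  connected : ∀ i j → Reach (Induced H (enum S)) i j
  connected i j = Reach-reflect {Induced H (enum S)} {H} (enum-closedEmbedding H closed) i j
    (Reach-trans (Reach-sym (reach _ (enum-sound S i))) (reach _ (enum-sound S j)))

mediant-≤ : ∀ {a b c d a′ b′} → a * d ≤ c * b → a′ * d ≤ c * b′ → (a + a′) * d ≤ c * (b + b′)
mediant-≤ {a} {b} {c} {d} {a′} {b′} ≤b ≤b′ =
  subst₂ _≤_ (sym (*-distribʳ-+ d a a′)) (sym (*-distribˡ-+ c b b′)) (+-mono-≤ ≤b ≤b′)

minor-density : ∀ {G C} → DensityMinimal G → Minor C G → ∣E∣ C * ∣V∣ G ≤ ∣E∣ G * ∣V∣ C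
minor-density {G} {C} _  (_ , ε , C≅G) =
  ≤-reflexive (trans (cong (_* ∣V∣ G) (≅⇒∣E∣≡ {C} {G} C≅G)) (cong (∣E∣ G *_) (sym (≅⇒∣V∣≡ {C} {G} C≅G))))
minor-density {G} {C} dm (_ , first ◅ rest , C≅H′) = <⇒≤ (dm C (_ , _ , first , rest , C≅H′))

ComponentFamily-density : ∀ {G H} → DensityMinimal G → ComponentFamily G H → ∣E∣ H * ∣V∣ G ≤ ∣E∣ G * ∣V∣ H
ComponentFamily-density {G} {H} dm = go (n H) H ≤-refl
  where
  go : ∀ t H → n H ≤ t → ComponentFamily G H → ∣E∣ H * ∣V∣ G ≤ ∣E∣ G * ∣V∣ H
  go _       (mkGraph zero _)    _       _   = z≤n
  go zero    (mkGraph (suc _) _) ()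
  go (suc t) H@(mkGraph (suc m) _) (s≤s m≤t) fam
    with C , H′ , C-comp@((C-nonempty , _) , _) , H′-emb , C⊕H′≅H ← peelComponent H zero =
    subst₂ (λ e v → e * ∣V∣ G ≤ ∣E∣ G * v) E-split V-split
      (mediant-≤ {∣E∣ C} {∣V∣ C} {∣E∣ G} {∣V∣ G} (minor-density {G} {C} dm (fam C C-comp)) (go t H′ H′≤t H′∈fam))
    where
    E-split : ∣E∣ C + ∣E∣ H′ ≡ ∣E∣ H
    E-split = trans (sym (∣E∣-⊕ C H′)) (≅⇒∣E∣≡ {C ⊕ H′} {H} C⊕H′≅H)
    V-split : ∣V∣ C + ∣V∣ H′ ≡ ∣V∣ H
    V-split = ≅⇒∣V∣≡ {C ⊕ H′} {H} C⊕H′≅H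
    H′≤t : n H′ ≤ t
    H′≤t = ≤-trans (≤-pred (subst (n H′ <_) V-split (+-monoˡ-≤ (n H′) C-nonempty))) m≤t
    H′∈fam : ComponentFamily G H′
    H′∈fam C′ (connected , f) = fam C′ (connected , closedEmbedding-∘ {C′} {H′} {H} H′-emb f)

Minor-◅ : ∀ {C G G′} → Step G G′ → Minor C G′ → Minor C G
Minor-◅ first (H′ , rest , C≅H′) = H′ , first ◅ rest , C≅H′

-- The vertex of C is needed: vertex deletion never produces the empty graph.
inducedMinor : ∀ {C} k (r : Fin k → Fin k → Bool) (f : Fin (n C) → Fin k) → Injective _≡_ _≡_ f →
  (∀ i j → Adj C i j ≡ Adj′ r (f i) (f j)) → Fin (n C) → Minor C (mkGraph k r)
inducedMinor {C} k r f f-inj f-ind c with any? (λ v → ¬? (any? λ i → f i ≟ v))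
... | no all-hit = mkGraph k r , ε , mk↔ₛ′ f f⁻¹ f∘f⁻¹ (λ i → f-inj (f∘f⁻¹ (f i))) , f-ind
  where
  hit : ∀ v → ∃ λ i → f i ≡ v
  hit v = decidable-stable (any? λ i → f i ≟ v) λ v∉ → all-hit (v , v∉)
  f⁻¹ : Fin k → Fin (n C)
  f⁻¹ v = proj₁ (hit v)
  f∘f⁻¹ : ∀ v → f (f⁻¹ v) ≡ v
  f∘f⁻¹ v = proj₂ (hit v)
inducedMinor (suc zero) r f f-inj f-ind c | yes (zero , v∉) with f c in fc≡
... | zero = ⊥-elim (v∉ (c , fc≡))
inducedMinor {C} (suc (suc k)) r f f-inj f-ind c | yes (v , v∉) =
  Minor-◅ {C} (vertexDeletion r v) (inducedMinor {C} (suc k) (delVertex r v) f′ f′-inj f′-ind c)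
  where
  v≢f : ∀ i → v ≢ f i
  v≢f i v≡fi = v∉ (i , sym v≡fi)
  f′ : Fin (n C) → Fin (suc k)
  f′ i = punchOut (v≢f i)
  f′-inj : Injective _≡_ _≡_ f′
  f′-inj {i} {j} eq = f-inj (punchOut-injective (v≢f i) (v≢f j) eq)
  f′-ind : ∀ i j → Adj C i j ≡ Adj′ (delVertex r v) (f′ i) (f′ j)
  f′-ind i j = trans (f-ind i j) (sym (trans (Adj-Induced (mkGraph _ r) (punchIn v) (f′ i) (f′ j))
                                             (cong₂ (Adj′ r) (punchIn-punchOut (v≢f i)) (punchIn-punchOut (v≢f j)))))

ComponentFamily-self : ∀ G → ComponentFamily G G
ComponentFamily-self G C ((nonempty , _) , f , f-inj , f-ind , _) =
  inducedMinor {C} (n G) (rel G) f f-inj f-ind (fromℕ< nonempty)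

ComponentFamily-⊕ : ∀ {G K₁ K₂} → ComponentFamily G K₁ → ComponentFamily G K₂ → ComponentFamily G (K₁ ⊕ K₂)
ComponentFamily-⊕ {K₁ = K₁} {K₂} K₁∈fam K₂∈fam C C-comp = [ K₁∈fam C , K₂∈fam C ]′ (⊕-component K₁ K₂ C-comp)

empty : Graph
empty = mkGraph 0 λ ()

copies : ℕ → Graph → Graph
copies zero    G = empty
copies (suc k) G = G ⊕ copies k G

ComponentFamily-copies : ∀ k G → ComponentFamily G (copies k G)
ComponentFamily-copies zero    G C ((nonempty , _) , f , _) with () ← f (fromℕ< nonempty)
ComponentFamily-copies (suc k) G = ComponentFamily-⊕ (ComponentFamily-self G) (ComponentFamily-copies k G)

∣V∣-copies : ∀ k G → ∣V∣ (copies k G) ≡ k * ∣V∣ G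
∣V∣-copies zero    G = refl
∣V∣-copies (suc k) G = cong (∣V∣ G +_) (∣V∣-copies k G)

∣E∣-copies : ∀ k G → ∣E∣ (copies k G) ≡ k * ∣E∣ G
∣E∣-copies zero    G = refl
∣E∣-copies (suc k) G = trans (∣E∣-⊕ G (copies k G)) (cong (∣E∣ G +_) (∣E∣-copies k G))

≤-∣V∣-copies : ∀ k G → 1 ≤ ∣V∣ G → k ≤ ∣V∣ (copies k G)
≤-∣V∣-copies zero    G _        = z≤n
≤-∣V∣-copies (suc k) G nonempty = +-mono-≤ nonempty (≤-∣V∣-copies k G nonempty)

density-copies : ∀ k G → ∣E∣ G * ∣V∣ (copies k G) ≡ ∣E∣ (copies k G) * ∣V∣ G
density-copies k G = begin
  ∣E∣ G * ∣V∣ (copies k G) ≡⟨ cong (∣E∣ G *_) (∣V∣-copies k G) ⟩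
  ∣E∣ G * (k * ∣V∣ G)      ≡⟨ *-assoc (∣E∣ G) k (∣V∣ G) ⟨
  ∣E∣ G * k * ∣V∣ G        ≡⟨ cong (_* ∣V∣ G) (trans (*-comm (∣E∣ G) k) (sym (∣E∣-copies k G))) ⟩
  ∣E∣ (copies k G) * ∣V∣ G ∎
  where open ≡-Reasoning

lemma7 : (G : Graph) → 1 ≤ ∣V∣ G → DensityMinimal G →
    ((q : ℕ) → ∃ λ N → (H : Graph) → ComponentFamily G H → N ≤ ∣V∣ H →
        ∣E∣ H * ∣V∣ G * suc q ≤ ∣E∣ G * ∣V∣ H * suc q + ∣V∣ G * ∣V∣ H)
    × ((q N : ℕ) → ∃ λ H → ComponentFamily G H × suc N ≤ ∣V∣ H ×
        ∣E∣ G * ∣V∣ H * suc q ≤ ∣E∣ H * ∣V∣ G * suc q + ∣V∣ G * ∣V∣ H)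
lemma7 G nonempty minimal =
  (λ q → 0 , λ H H∈fam _ →
     ≤-trans (*-monoˡ-≤ (suc q) (ComponentFamily-density {G} {H} minimal H∈fam)) (m≤m+n _ _)) ,
  (λ q N → copies (suc N) G , ComponentFamily-copies (suc N) G , ≤-∣V∣-copies (suc N) G nonempty ,
     ≤-trans (≤-reflexive (cong (_* suc q) (density-copies (suc N) G))) (m≤m+n _ _))
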